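{- Let $G_1=(V_1,E_1)$ (the demand graph) and $G_2=(V_2,E_2)$ (the supply graph) be finite undirected graphs, and let every node $v\in V_1$ have a nonempty set $S(v)\subseteq V_2$ of supply nodes. Let $\tilde G_1$ be the colored graph obtained from $G_1$ by the transformation described in the context. Then for every set $V_s\subseteq V_2$: $V_s$ is a supply node cut of $G_1$ if and only if $V_s$, regarded as a set of colors of $\tilde G_1$, is a color node cut of $\tilde G_1$. In this sense there is a one-to-one correspondence between supply node cuts of $G_1$ and color node cuts of $\tilde G_1$.
   Context: A node cut of a graph $H$ is a set $X$ of nodes of $H$ such that removing $X$ from $H$ either leaves a graph with more than one connected component or leaves exactly one node. A supply node cut of $G_1$ is a set $V_s\subseteq V_2$ such that the set $V_d=\{v\in V_1: S(v)\subseteq V_s\}$ of demand nodes having no supply node outside $V_s$ contains a node cut of $G_1$. A colored graph is a graph in which each node carries exactly one color. A color node cut of a colored graph $G$ is a set $C_c$ of colors such that the set of nodes of $G$ whose color lies in $C_c$ contains a node cut of $G$. The transformed graph $\tilde G_1$: for each $v\in V_1$ with $|S(v)|=n_s(v)$, $\tilde G_1$ contains $n_s(v)$ copies of $v$, one for each $u\in S(v)$, and that copy has color $u$ (so colors are elements of $V_2$); there are no edges between copies of the same node; if $v_iv_j\in E_1$ then every copy of $v_i$ is adjacent to every copy of $v_j$, and there are no other edges. -}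

module Defs where

open import Level using (0ℓ)
open import Data.Bool using (Bool; true; false)
open import Data.Nat using (ℕ)
open import Data.Fin using (Fin)
open import Data.Fin.Subset using (Subset; _∈_; _⊆_; Nonempty)
open import Data.Product using (Σ; ∃; _×_; _,_)
open import Data.Sum using (_⊎_)
open import Relation.Nullary using (¬_)
open import Relation.Binary.PropositionalEquality using (_≡_)

record Graph (V : Set) : Set where
  field
    Adj      : V → V → Bool
    sym      : ∀ x y → Adj x y ≡ Adj y x
    loopless : ∀ x → Adj x x ≡ false
open Graph public

NodeSet : Set → Set₁
NodeSet V = V → Set

data Reach {V : Set} (H : Graph V) (X : NodeSet V) : V → V → Set where
  here : ∀ {a} → ¬ X a → Reach H X a a
  step : ∀ {a b c} → ¬ X a → Adj H a b ≡ true → Reach H X b c → Reach H X a c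

-- X is a node cut of H: H - X has more than one connected component
-- (two surviving nodes not connected in H - X) or exactly one node.
NodeCut : {V : Set} → Graph V → NodeSet V → Set
NodeCut {V} H X =
  (Σ V λ a → Σ V λ b → ¬ X a × ¬ X b × ¬ Reach H X a b)
  ⊎ (Σ V λ a → ¬ X a × (∀ b → ¬ X b → b ≡ a))

ContainsNodeCut : {V : Set} → Graph V → NodeSet V → Set₁
ContainsNodeCut {V} H Y = Σ (NodeSet V) λ X → (∀ x → X x → Y x) × NodeCut H X

SupplyNodeCut : {n₁ n₂ : ℕ} → Graph (Fin n₁) → (Fin n₁ → Subset n₂) → Subset n₂ → Set₁
SupplyNodeCut G₁ S Vs = ContainsNodeCut G₁ (λ v → S v ⊆ Vs)

record ColoredGraph (V : Set) (k : ℕ) : Set where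
  field
    graph : Graph V
    color : V → Fin k
open ColoredGraph public

ColorNodeCut : {V : Set} {k : ℕ} → ColoredGraph V k → Subset k → Set₁
ColorNodeCut G Cc = ContainsNodeCut (graph G) (λ x → color G x ∈ Cc)

-- Nodes of the transformed graph: copies (v , u) of v, one per u ∈ S v.
TNode : {n₁ n₂ : ℕ} → (Fin n₁ → Subset n₂) → Set
TNode {n₁} {n₂} S = Σ (Fin n₁) λ v → Σ (Fin n₂) λ u → u ∈ S v

transformed : {n₁ n₂ : ℕ} → Graph (Fin n₁) → (S : Fin n₁ → Subset n₂) → ColoredGraph (TNode S) n₂
transformed G₁ S = record
  { graph = record
      { Adj      = λ { (v , _) (w , _) → Adj G₁ v w }
      ; sym      = λ { (v , _) (w , _) → sym G₁ v w }
      ; loopless = λ { (v , _) → loopless G₁ v }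
      }
  ; color = λ { (_ , u , _) → u }
  }

module Submission where

-- G̃₁ is a "blow-up" of G₁ along the projection π : (v , u , p) ↦ v: every
-- node v is replaced by the independent set of its copies (the fibre of π
-- over v), and Adj̃ A B = Adj (π A) (π B).  The argument is done for an
-- arbitrary blow-up H of a graph G:
--   * forward: if X is a node cut of G then π⁻¹ X is a node cut of H
--     (paths project along π; a unique survivor of G - X either has a unique
--     copy, or two copies which are not adjacent and have no other neighbour);
--   * backward: if Y is a decidable node cut of H then the set of nodes all
--     of whose copies lie in Y is a node cut of G (paths of G - X lift to H - Y
--     once they have an edge; otherwise a survivor with no surviving neighbour
--     already yields a cut).
-- A color node cut is first replaced by a decidable one (enlarging a cut
-- keeps it a cut as long as the witnesses survive).

open import Defs
open import Data.Nat using (ℕ)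
open import Data.Fin using (Fin)
open import Data.Fin.Subset using (Subset; Nonempty; _∈_)
open import Data.Fin.Subset.Properties using (_∈?_)
open import Data.Fin.Properties using (any?) renaming (_≟_ to _≟F_)
open import Data.Bool using (true)
open import Data.Bool.Properties using () renaming (_≟_ to _≟B_)
open import Data.Product using (Σ; _×_; _,_; proj₁; proj₂)
open import Data.Sum using (_⊎_; inj₁; inj₂)
open import Data.Empty using (⊥-elim)
open import Data.Vec.Properties.WithK using ([]=-irrelevant)
open import Function using (_∘_)
open import Function.Bundles using (_⇔_; mk⇔)
open import Relation.Nullary using (¬_; Dec; yes; no)
open import Relation.Nullary.Decidable using (_×-dec_; ¬?)
open import Relation.Binary.Definitions using (DecidableEquality)
open import Relation.Binary.PropositionalEquality
  using (_≡_; refl; trans; cong; subst) renaming (sym to ≡-sym)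

SurvivingNeighbour : {V : Set} → Graph V → NodeSet V → V → Set
SurvivingNeighbour {V} G X a = Σ V λ w → Adj G a w ≡ true × ¬ X w

FibreDecision : {V T : Set} → (T → V) → (T → Set) → V → Set
FibreDecision {V} {T} π P v = (∀ A → π A ≡ v → P A) ⊎ (Σ T λ A → π A ≡ v × ¬ P A)

reach-source : ∀ {V} {G : Graph V} {X : NodeSet V} {a b} → Reach G X a b → ¬ X a
reach-source (here nx)     = nx
reach-source (step nx _ _) = nx

reach-antitone : ∀ {V} {G : Graph V} {X Y : NodeSet V} → (∀ x → Y x → X x) →
                 ∀ {a b} → Reach G X a b → Reach G Y a b
reach-antitone Y⊆X (here nx)     = here (nx ∘ Y⊆X _)
reach-antitone Y⊆X (step nx e r) = step (nx ∘ Y⊆X _) e (reach-antitone Y⊆X r)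

isolated-reach : ∀ {V} {G : Graph V} {X : NodeSet V} {a b} →
                 ¬ SurvivingNeighbour G X a → Reach G X a b → a ≡ b
isolated-reach iso (here _)              = refl
isolated-reach iso (step {b = w} _ e r) = ⊥-elim (iso (w , e , reach-source r))

unique-survivor-isolated : ∀ {V} (G : Graph V) {X : NodeSet V} {a} →
                           (∀ b → ¬ X b → b ≡ a) → ¬ SurvivingNeighbour G X a
unique-survivor-isolated G {a = a} only (w , e , nxw) with only w nxw
... | refl with trans (≡-sym e) (loopless G a)
...   | ()

-- On a finite graph, a survivor with no surviving neighbour gives a node cut:
-- either another survivor exists (and is unreachable) or it is the only one.
isolated-survivor-cut : ∀ {n} (G : Graph (Fin n)) {X : NodeSet (Fin n)} →
                        (∀ v → Dec (X v)) → ∀ {a} → ¬ X a →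
                        ¬ SurvivingNeighbour G X a → NodeCut G X
isolated-survivor-cut G {X} X? {a} nxa iso
  with any? (λ c → ¬? (c ≟F a) ×-dec ¬? (X? c))
... | yes (c , c≢a , nxc) = inj₁ (a , c , nxa , nxc , λ r → c≢a (≡-sym (isolated-reach iso r)))
... | no none = inj₂ (a , nxa , only)
  where
  only : ∀ c → ¬ X c → c ≡ a
  only c nxc with c ≟F a
  ... | yes c≡a = c≡a
  ... | no c≢a  = ⊥-elim (none (c , c≢a , nxc))

-- A node cut inside a decidable set Z can be replaced by a decidable one
-- inside Z: remove all of Z except the witnesses of the cut.
decidable-node-cut : ∀ {T} (H : Graph T) → DecidableEquality T →
                     (Z : NodeSet T) → (∀ x → Dec (Z x)) → ContainsNodeCut H Z →
                     Σ (NodeSet T) λ Y → (∀ x → Dec (Y x)) × (∀ x → Y x → Z x) × NodeCut H Y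
decidable-node-cut H _≟_ Z Z? (X , X⊆Z , inj₁ (A , B , nxA , nxB , nr)) =
  Y , (λ x → Z? x ×-dec (¬? (x ≟ A) ×-dec ¬? (x ≟ B))) , (λ _ → proj₁) ,
  inj₁ (A , B , (λ y → proj₁ (proj₂ y) refl) , (λ y → proj₂ (proj₂ y) refl) ,
        nr ∘ reach-antitone X⊆Y)
  where
  Y : NodeSet _
  Y x = Z x × ¬ x ≡ A × ¬ x ≡ B
  X⊆Y : ∀ x → X x → Y x
  X⊆Y x xx = X⊆Z x xx , (λ { refl → nxA xx }) , (λ { refl → nxB xx })
decidable-node-cut H _≟_ Z Z? (X , X⊆Z , inj₂ (A , nxA , only)) =
  (λ x → ¬ x ≡ A) , (λ x → ¬? (x ≟ A)) , Y⊆Z , inj₂ (A , (λ n → n refl) , onlyA)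
  where
  Y⊆Z : ∀ x → ¬ x ≡ A → Z x
  Y⊆Z x x≢A with Z? x
  ... | yes z = z
  ... | no nz = ⊥-elim (x≢A (only x (nz ∘ X⊆Z x)))
  onlyA : ∀ x → ¬ ¬ x ≡ A → x ≡ A
  onlyA x nn with x ≟ A
  ... | yes e  = e
  ... | no x≢A = ⊥-elim (nn x≢A)

-- Blow-ups: H is a blow-up of the finite graph G along π when adjacency in H
-- is adjacency of the images in G (so each fibre of π is an independent set).
module BlowUp {n : ℕ} {T : Set} (G : Graph (Fin n)) (H : Graph T) (π : T → Fin n)
              (adj : ∀ A B → Adj H A B ≡ Adj G (π A) (π B)) where

  edge-lift : ∀ {A B a b} → π A ≡ a → π B ≡ b → Adj G a b ≡ true → Adj H A B ≡ true
  edge-lift {A} {B} refl refl e = trans (adj A B) e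

  reach-project : ∀ {X : NodeSet (Fin n)} {A B} → Reach H (X ∘ π) A B → Reach G X (π A) (π B)
  reach-project (here nx)     = here nx
  reach-project (step nx e r) = step nx (trans (≡-sym (adj _ _)) e) (reach-project r)

  isolated-lift : ∀ {X : NodeSet (Fin n)} {A} →
                  ¬ SurvivingNeighbour G X (π A) → ¬ SurvivingNeighbour H (X ∘ π) A
  isolated-lift {A = A} iso (W , e , nxW) = iso (π W , trans (≡-sym (adj A W)) e , nxW)

  cut-forward : (σ : ∀ v → Σ T λ A → π A ≡ v) →
                (∀ A → FibreDecision π (_≡ A) (π A)) →
                ∀ {X : NodeSet (Fin n)} → NodeCut G X → NodeCut H (X ∘ π)
  cut-forward σ fibre (inj₁ (a , b , nxa , nxb , nr))
    with σ a | σ b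
  ... | A , refl | B , refl = inj₁ (A , B , nxa , nxb , nr ∘ reach-project)
  cut-forward σ fibre {X} (inj₂ (a , nxa , only)) with σ a
  ... | A , refl with fibre A
  ...   | inj₁ all≡A = inj₂ (A , nxa , λ B nxB → all≡A B (only (π B) nxB))
  ...   | inj₂ (B , πB≡πA , B≢A) =
    inj₁ (A , B , nxa , subst (λ v → ¬ X v) (≡-sym πB≡πA) nxa ,
          λ r → B≢A (≡-sym (isolated-reach (isolated-lift (unique-survivor-isolated G only)) r)))

  module Backward (Y : NodeSet T) (fibre : ∀ v → FibreDecision π Y v) where

    AllCopiesIn : NodeSet (Fin n)
    AllCopiesIn v = ∀ A → π A ≡ v → Y A

    surviving-copy : ∀ {v} → ¬ AllCopiesIn v → Σ T λ A → π A ≡ v × ¬ Y A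
    surviving-copy {v} nx with fibre v
    ... | inj₁ all   = ⊥-elim (nx all)
    ... | inj₂ copy  = copy

    AllCopiesIn? : ∀ v → Dec (AllCopiesIn v)
    AllCopiesIn? v with fibre v
    ... | inj₁ all                = yes all
    ... | inj₂ (A , refl , nyA)   = no λ all → nyA (all A refl)

    reach-lift : ∀ {A B a w b} → π A ≡ a → Adj G a w ≡ true → Reach G AllCopiesIn w b →
                 π B ≡ b → ¬ Y A → ¬ Y B → Reach H Y A B
    reach-lift πA e (here _) πB nyA nyB = step nyA (edge-lift πA πB e) (here nyB)
    reach-lift πA e (step nxw e′ r) πB nyA nyB with surviving-copy nxw
    ... | W , πW , nyW = step nyA (edge-lift πA πW e) (reach-lift πW e′ r πB nyW nyB)

    cut-backward : NodeCut H Y → NodeCut G AllCopiesIn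
    cut-backward (inj₂ (A , nyA , only)) =
      inj₂ (π A , (λ all → nyA (all A refl)) , only-πA)
      where
      only-πA : ∀ c → ¬ AllCopiesIn c → c ≡ π A
      only-πA c nxc with surviving-copy nxc
      ... | C , refl , nyC = cong π (only C nyC)
    cut-backward (inj₁ (A , B , nyA , nyB , nr))
      with any? (λ w → (Adj G (π A) w ≟B true) ×-dec ¬? (AllCopiesIn? w))
    ... | no iso = isolated-survivor-cut G AllCopiesIn? nxA iso
      where
      nxA : ¬ AllCopiesIn (π A)
      nxA all = nyA (all A refl)
    ... | yes (w , e , nxw) =
      inj₁ (π A , π B , (λ all → nyA (all A refl)) , (λ all → nyB (all B refl)) ,
            λ r → nr (reach-lift refl e (step nxw (trans (sym G w (π A)) e) r) refl nyA nyB))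

module _ {n₁ n₂ : ℕ} (S : Fin n₁ → Subset n₂) where

  -- Copies are equal when their nodes and colors are (membership proofs
  -- in a subset are unique).
  _≟-copy_ : DecidableEquality (TNode S)
  (v , u , p) ≟-copy (w , u′ , p′) with v ≟F w | u ≟F u′
  ... | yes refl | yes refl = yes (cong (λ q → v , u , q) ([]=-irrelevant p p′))
  ... | no v≢w   | _        = no λ { refl → v≢w refl }
  ... | yes _    | no u≢u′  = no λ { refl → u≢u′ refl }

  -- Every decidable predicate has decidable fibres over the demand nodes,
  -- by searching the colors u ∈ S v.
  fibre-search : (P : TNode S → Set) → (∀ A → Dec (P A)) →
                 ∀ v → FibreDecision proj₁ P v
  fibre-search P P? v with any? counterexample?
    where
    counterexample? : ∀ u → Dec (Σ (u ∈ S v) λ p → ¬ P (v , u , p))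
    counterexample? u with u ∈? S v
    ... | no u∉S = no λ { (p , _) → u∉S p }
    ... | yes p with P? (v , u , p)
    ...   | no np = yes (p , np)
    ...   | yes y = no λ { (p′ , np′) → np′ (subst (λ q → P (v , u , q)) ([]=-irrelevant p p′) y) }
  ... | yes (u , p , np) = inj₂ ((v , u , p) , refl , np)
  ... | no none = inj₁ all
    where
    all : ∀ A → proj₁ A ≡ v → P A
    all (_ , u , p) refl with P? (v , u , p)
    ... | yes y  = y
    ... | no np  = ⊥-elim (none (u , p , np))

-- The theorem: G̃₁ is the blow-up of G₁ along the projection of copies,
-- which is surjective because every S v is nonempty.
theorem1 : (n₁ n₂ : ℕ) (G₁ : Graph (Fin n₁)) (G₂ : Graph (Fin n₂))
           (S : Fin n₁ → Subset n₂) → (∀ v → Nonempty (S v)) →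
           (Vs : Subset n₂) →
           SupplyNodeCut G₁ S Vs ⇔ ColorNodeCut (transformed G₁ S) Vs
theorem1 n₁ n₂ G₁ G₂ S nonempty Vs = mk⇔ forward backward
  where
  G̃₁ : Graph (TNode S)
  G̃₁ = graph (transformed G₁ S)
  open BlowUp G₁ G̃₁ proj₁ (λ _ _ → refl)

  forward : SupplyNodeCut G₁ S Vs → ColorNodeCut (transformed G₁ S) Vs
  forward (X , X⊆Vd , cut) =
    X ∘ proj₁ , (λ { (v , u , p) xv → X⊆Vd v xv p }) ,
    cut-forward (λ v → (v , nonempty v) , refl)
                (λ A → fibre-search S (_≡ A) (λ B → _≟-copy_ S B A) (proj₁ A)) cut

  backward : ColorNodeCut (transformed G₁ S) Vs → SupplyNodeCut G₁ S Vs
  backward colorCut with decidable-node-cut G̃₁ (_≟-copy_ S) (λ A → proj₁ (proj₂ A) ∈ Vs)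
                                            (λ A → proj₁ (proj₂ A) ∈? Vs) colorCut
  ... | Y , Y? , Y⊆Vs , cut =
    AllCopiesIn , (λ v all {u} p → Y⊆Vs (v , u , p) (all (v , u , p) refl)) , cut-backward cut
    where open Backward Y (fibre-search S Y Y?)
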